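{- Let $G$ be a graph and $v$ a vertex of $G$. The map $\Phi:\Pi_v^v(G)\to D(G)$ given by $[\gamma]\mapsto\psi_\gamma$ is an isomorphism of groups.
   Context: All graphs are undirected, have no multiple edges, may have loops, are connected, and are not a single isolated vertex. A walk is a sequence $(v_0\cdots v_n)$ with $v_i\sim v_{i+1}$. A prune of a walk with $v_i=v_{i+2}$ replaces the segment $v_iv_{i+1}v_i$ by $v_i$. A spider move on $(v_0\cdots v_n)$ replaces one vertex $v_i$, $0<i<n$, by $v_i'$ with $v_{i-1}\sim v_i'\sim v_{i+1}$. Walks are equivalent if connected by finitely many prunes, inverse prunes and spider moves. The fundamental groupoid $\Pi(G)$ has objects the vertices and arrows $v\to w$ the equivalence classes of walks from $v$ to $w$, composed by concatenation ($\alpha*\beta$ is $\alpha$ followed by $\beta$); $\Pi_v(G)$ is the set of arrows with source $v$, and $\Pi_v^v(G)$ is the group of arrows from $v$ to $v$. The universal homotopy cover $U=U_vG$ is the graph whose vertices are the arrows in $\Pi_v(G)$, with $\alpha\sim\beta$ iff $\beta=\alpha*[(wx)]$ for an edge $w\sim x$ with $w$ the target of $\alpha$; $\rho:U\to G$ sends an arrow to its target. $D(G)$ is the group (under composition) of graph automorphisms $\varphi$ of $U$ with $\rho\circ\varphi=\rho$ (deck transformations). For $\gamma\in\Pi_v^v(G)$, $\psi_\gamma:U\to U$ is $\psi_\gamma(\alpha)=\gamma*\alpha$. -}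

module Defs where

open import Data.Product using (Σ; Σ-syntax; _×_; _,_; proj₁; proj₂)
open import Data.Sum using (_⊎_)
open import Relation.Nullary using (¬_)
open import Relation.Binary.PropositionalEquality using (_≡_)
open import Relation.Binary.Construct.Closure.Equivalence using (EqClosure)

-- A graph: undirected (symmetric adjacency), no multiple edges
-- (adjacency is proof-irrelevant), loops allowed (x ∼ x permitted).
record Graph : Set₁ where
  field
    V      : Set
    _∼_    : V → V → Set
    ∼-sym  : ∀ {x y} → x ∼ y → y ∼ x
    ∼-prop : ∀ {x y} (e f : x ∼ y) → e ≡ f

module _ (G : Graph) where
  open Graph G

  infixr 5 _∷_
  data Walk : V → V → Set where
    [_] : (v : V) → Walk v v
    _∷_ : ∀ {u w x} → u ∼ w → Walk w x → Walk u x

  infixr 5 _++_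
  _++_ : ∀ {u w x} → Walk u w → Walk w x → Walk u x
  [ _ ]   ++ q = q
  (e ∷ p) ++ q = e ∷ (p ++ q)

  edge : ∀ {w x} → w ∼ x → Walk w x
  edge {x = x} e = e ∷ [ x ]

  Connected : Set
  Connected = ∀ x y → Walk x y

  NotSingleIsolatedVertex : Set
  NotSingleIsolatedVertex = ¬ ((∀ (x y : V) → x ≡ y) × (∀ (x y : V) → ¬ (x ∼ y)))

  data Prune : ∀ {u x : V} → Walk u x → Walk u x → Set where
    here  : ∀ {a b x} (e : a ∼ b) (f : b ∼ a) (w : Walk a x) →
            Prune (e ∷ f ∷ w) w
    there : ∀ {u w x} (e : u ∼ w) {p q : Walk w x} →
            Prune p q → Prune (e ∷ p) (e ∷ q)

  data Spider : ∀ {u x : V} → Walk u x → Walk u x → Set where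
    here  : ∀ {a b b' c x} (e : a ∼ b) (f : b ∼ c) (e' : a ∼ b') (f' : b' ∼ c)
            (w : Walk c x) → Spider (e ∷ f ∷ w) (e' ∷ f' ∷ w)
    there : ∀ {u w x} (e : u ∼ w) {p q : Walk w x} →
            Spider p q → Spider (e ∷ p) (e ∷ q)

  Move : ∀ {u x : V} → Walk u x → Walk u x → Set
  Move p q = Prune p q ⊎ Spider p q

  _≃_ : ∀ {u x : V} → Walk u x → Walk u x → Set
  _≃_ = EqClosure Move

  -- Π_v(G): arrows with source v (represented by walks, up to ≈ₐ)
  Arrow : V → Set
  Arrow v = Σ V (Walk v)

  data _≈ₐ_ {v : V} : Arrow v → Arrow v → Set where
    eq : ∀ {x} {p q : Walk v x} → p ≃ q → (x , p) ≈ₐ (x , q)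

  -- Π_v^v(G): loops at v (up to ≃), with composition _++_

  ρ : ∀ {v} → Arrow v → V
  ρ = proj₁

  _∼U_ : ∀ {v} → Arrow v → Arrow v → Set
  (w , α) ∼U β = Σ[ x ∈ V ] Σ[ e ∈ w ∼ x ] (β ≈ₐ (x , α ++ edge e))

  -- deck transformations: graph automorphisms φ of U (on the setoid of
  -- vertices of U) with ρ ∘ φ = ρ
  record IsDeck {v : V} (φ : Arrow v → Arrow v) : Set where
    field
      cong     : ∀ {α β} → α ≈ₐ β → φ α ≈ₐ φ β
      inv      : Arrow v → Arrow v
      inv-cong : ∀ {α β} → α ≈ₐ β → inv α ≈ₐ inv β
      inv-ˡ    : ∀ α → inv (φ α) ≈ₐ α
      inv-ʳ    : ∀ α → φ (inv α) ≈ₐ α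
      adj-pres : ∀ {α β} → α ∼U β → φ α ∼U φ β
      adj-refl : ∀ {α β} → φ α ∼U φ β → α ∼U β
      over     : ∀ α → ρ (φ α) ≡ ρ α

  ψ : ∀ {v} → Walk v v → Arrow v → Arrow v
  ψ γ (x , α) = x , (γ ++ α)

-- Left multiplication ψ_γ is a deck transformation: its inverse is ψ_{γ⁻¹}, where γ⁻¹ is the
-- reversed walk, and it commutes with appending an edge. Evaluating ψ_γ at the identity arrow
-- [v] recovers [γ], so Φ is injective. Conversely, a map of U over ρ that preserves adjacency
-- is pinned down by its value at [v]: the neighbour of an arrow over a given vertex is unique
-- (G has no multiple edges), so agreement with ψ_γ propagates from [v] along any walk.
module Submission where

open import Defs
open import Data.Product using (Σ; Σ-syntax; _×_; _,_)
open import Data.Sum using (inj₁; inj₂)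
open import Function using (_∘_)
open import Relation.Binary.PropositionalEquality using (_≡_; refl; sym; cong; subst)
open import Relation.Binary.Construct.Closure.Equivalence as EC using (gmap; return)
import Relation.Binary.Reasoning.Setoid as SetoidReasoning

module Cover (G : Graph) where
  open Graph G

  private
    infixr 5 _⊕_
    infix 4 _≅_ _≈_ _~_

    _⊕_ : ∀ {u w x} → Walk G u w → Walk G w x → Walk G u x
    _⊕_ = _++_ G

    _≅_ : ∀ {u x} → Walk G u x → Walk G u x → Set
    _≅_ = _≃_ G

    _≈_ : ∀ {v} → Arrow G v → Arrow G v → Set
    _≈_ = _≈ₐ_ G

    _~_ : ∀ {v} → Arrow G v → Arrow G v → Set
    _~_ = _∼U_ G

  ≅-refl : ∀ {u x} {p : Walk G u x} → p ≅ p
  ≅-refl = EC.reflexive (Move G)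

  ≅-reflexive : ∀ {u x} {p q : Walk G u x} → p ≡ q → p ≅ q
  ≅-reflexive refl = ≅-refl

  ≅-sym : ∀ {u x} {p q : Walk G u x} → p ≅ q → q ≅ p
  ≅-sym = EC.symmetric (Move G)

  ≅-trans : ∀ {u x} {p q r : Walk G u x} → p ≅ q → q ≅ r → p ≅ r
  ≅-trans = EC.transitive (Move G)

  module ≅-Reasoning {u x : V} = SetoidReasoning (EC.setoid (Move G {u} {x}))

  ≈-refl : ∀ {v} {α : Arrow G v} → α ≈ α
  ≈-refl = eq ≅-refl

  ≈-trans : ∀ {v} {α β γ : Arrow G v} → α ≈ β → β ≈ γ → α ≈ γ
  ≈-trans (eq p≅q) (eq q≅r) = eq (≅-trans p≅q q≅r)

  ++-assoc : ∀ {a b c d} (p : Walk G a b) (q : Walk G b c) (r : Walk G c d) →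
             (p ⊕ q) ⊕ r ≡ p ⊕ (q ⊕ r)
  ++-assoc [ _ ]   q r = refl
  ++-assoc (e ∷ p) q r = cong (e ∷_) (++-assoc p q r)

  ++-identityʳ : ∀ {a b} (p : Walk G a b) → p ⊕ [ b ] ≡ p
  ++-identityʳ [ _ ]   = refl
  ++-identityʳ (e ∷ p) = cong (e ∷_) (++-identityʳ p)

  reverse : ∀ {a b} → Walk G a b → Walk G b a
  reverse [ a ]   = [ a ]
  reverse (e ∷ p) = reverse p ⊕ edge G (∼-sym e)

  prune : ∀ {a b x} (e : a ∼ b) (f : b ∼ a) (p : Walk G a x) → e ∷ f ∷ p ≅ p
  prune e f p = return (inj₁ (here e f p))

  move-++ˡ : ∀ {a u x} (r : Walk G a u) {p q : Walk G u x} →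
             Move G p q → Move G (r ⊕ p) (r ⊕ q)
  move-++ˡ [ _ ]   m = m
  move-++ˡ (e ∷ r) m with move-++ˡ r m
  ... | inj₁ pr = inj₁ (there e pr)
  ... | inj₂ sp = inj₂ (there e sp)

  prune-++ʳ : ∀ {u x y} (r : Walk G x y) {p q : Walk G u x} →
              Prune G p q → Prune G (p ⊕ r) (q ⊕ r)
  prune-++ʳ r (here e f p) = here e f (p ⊕ r)
  prune-++ʳ r (there e m)  = there e (prune-++ʳ r m)

  spider-++ʳ : ∀ {u x y} (r : Walk G x y) {p q : Walk G u x} →
               Spider G p q → Spider G (p ⊕ r) (q ⊕ r)
  spider-++ʳ r (here e f e′ f′ p) = here e f e′ f′ (p ⊕ r)
  spider-++ʳ r (there e m)        = there e (spider-++ʳ r m)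

  move-++ʳ : ∀ {u x y} (r : Walk G x y) {p q : Walk G u x} →
             Move G p q → Move G (p ⊕ r) (q ⊕ r)
  move-++ʳ r (inj₁ m) = inj₁ (prune-++ʳ r m)
  move-++ʳ r (inj₂ m) = inj₂ (spider-++ʳ r m)

  ++-congˡ : ∀ {a u x} (r : Walk G a u) {p q : Walk G u x} → p ≅ q → r ⊕ p ≅ r ⊕ q
  ++-congˡ r = gmap (r ⊕_) (move-++ˡ r)

  ++-congʳ : ∀ {u x y} (r : Walk G x y) {p q : Walk G u x} → p ≅ q → p ⊕ r ≅ q ⊕ r
  ++-congʳ r = gmap (_⊕ r) (move-++ʳ r)

  reverse-++-cancelˡ : ∀ {a b x} (γ : Walk G a b) (p : Walk G b x) → reverse γ ⊕ γ ⊕ p ≅ p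
  reverse-++-cancelˡ [ _ ]   p = ≅-refl
  reverse-++-cancelˡ (e ∷ γ) p = begin
    (reverse γ ⊕ edge G (∼-sym e)) ⊕ e ∷ γ ⊕ p  ≡⟨ ++-assoc (reverse γ) _ _ ⟩
    reverse γ ⊕ ∼-sym e ∷ e ∷ γ ⊕ p             ≈⟨ ++-congˡ (reverse γ) (prune _ e _) ⟩
    reverse γ ⊕ γ ⊕ p                           ≈⟨ reverse-++-cancelˡ γ p ⟩
    p                                           ∎
    where open ≅-Reasoning

  ++-reverse-cancelˡ : ∀ {a b x} (γ : Walk G a b) (q : Walk G a x) → γ ⊕ reverse γ ⊕ q ≅ q
  ++-reverse-cancelˡ [ _ ]   q = ≅-refl
  ++-reverse-cancelˡ (e ∷ γ) q = begin
    e ∷ γ ⊕ (reverse γ ⊕ edge G (∼-sym e)) ⊕ q  ≡⟨ cong (λ r → e ∷ γ ⊕ r) (++-assoc (reverse γ) _ q) ⟩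
    e ∷ γ ⊕ reverse γ ⊕ ∼-sym e ∷ q             ≈⟨ ++-congˡ (edge G e) (++-reverse-cancelˡ γ _) ⟩
    e ∷ ∼-sym e ∷ q                             ≈⟨ prune e _ q ⟩
    q                                           ∎
    where open ≅-Reasoning

  ++-cancelˡ : ∀ {a b x} (γ : Walk G a b) {p q : Walk G b x} → γ ⊕ p ≅ γ ⊕ q → p ≅ q
  ++-cancelˡ γ {p} {q} γp≅γq = begin
    p                  ≈⟨ ≅-sym (reverse-++-cancelˡ γ p) ⟩
    reverse γ ⊕ γ ⊕ p  ≈⟨ ++-congˡ (reverse γ) γp≅γq ⟩
    reverse γ ⊕ γ ⊕ q  ≈⟨ reverse-++-cancelˡ γ q ⟩
    q                  ∎
    where open ≅-Reasoning

  module _ {v : V} where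

    ψ-cong : (γ : Walk G v v) {α β : Arrow G v} → α ≈ β → ψ G γ α ≈ ψ G γ β
    ψ-cong γ (eq p≅q) = eq (++-congˡ γ p≅q)

    ψ-∼U : (γ : Walk G v v) {α β : Arrow G v} → α ~ β → ψ G γ α ~ ψ G γ β
    ψ-∼U γ {w , p} (x , e , β≈pe) =
      x , e , ≈-trans (ψ-cong γ β≈pe) (eq (≅-reflexive (sym (++-assoc γ p (edge G e)))))

    ψ-∼U⁻¹ : (γ : Walk G v v) {α β : Arrow G v} → ψ G γ α ~ ψ G γ β → α ~ β
    ψ-∼U⁻¹ γ {w , p} (x , e , eq γq≅γpe) =
      x , e , eq (++-cancelˡ γ (≅-trans γq≅γpe (≅-reflexive (++-assoc γ p (edge G e)))))

    ψ-isDeck : (γ : Walk G v v) → IsDeck G (ψ G γ)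
    ψ-isDeck γ = record
      { cong     = ψ-cong γ
      ; inv      = ψ G (reverse γ)
      ; inv-cong = ψ-cong (reverse γ)
      ; inv-ˡ    = λ { (_ , p) → eq (reverse-++-cancelˡ γ p) }
      ; inv-ʳ    = λ { (_ , p) → eq (++-reverse-cancelˡ γ p) }
      ; adj-pres = ψ-∼U γ
      ; adj-refl = ψ-∼U⁻¹ γ
      ; over     = λ _ → refl
      }

    ψ-resp-≃ : (γ δ : Walk G v v) → γ ≅ δ → ∀ α → ψ G γ α ≈ ψ G δ α
    ψ-resp-≃ γ δ γ≅δ (_ , p) = eq (++-congʳ p γ≅δ)

    ψ-++ : (γ δ : Walk G v v) → ∀ α → ψ G (γ ⊕ δ) α ≈ ψ G γ (ψ G δ α)
    ψ-++ γ δ (_ , p) = eq (≅-reflexive (++-assoc γ δ p))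

    ψ-injective : (γ δ : Walk G v v) → (∀ α → ψ G γ α ≈ ψ G δ α) → γ ≅ δ
    ψ-injective γ δ ψγ≈ψδ with ψγ≈ψδ (v , [ v ])
    ... | eq γ≅δ = begin
      γ          ≡⟨ sym (++-identityʳ γ) ⟩
      γ ⊕ [ v ]  ≈⟨ γ≅δ ⟩
      δ ⊕ [ v ]  ≡⟨ ++-identityʳ δ ⟩
      δ          ∎
      where open ≅-Reasoning

    -- Uniqueness of edge lifting; the edges e and e′ below coincide since adjacency is a proposition.
    ∼U-unique : ∀ {x x′} (r : Walk G v x) (e : x ∼ x′) {α β : Arrow G v} →
                (x , r) ≈ α → α ~ β → ρ G β ≡ x′ → (x′ , r ⊕ edge G e) ≈ β
    ∼U-unique r e (eq r≅p) (_ , e′ , eq q≅pe′) refl with ∼-prop e e′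
    ... | refl = eq (≅-trans (++-congʳ (edge G e) r≅p) (≅-sym q≅pe′))

    loopAt : (α : Arrow G v) → ρ G α ≡ v → Walk G v v
    loopAt (_ , p) refl = p

    loopAt-≈ : (α : Arrow G v) (ρα≡v : ρ G α ≡ v) → (v , loopAt α ρα≡v) ≈ α
    loopAt-≈ (_ , p) refl = ≈-refl

    ∼U-preserving-over-ρ⇒ψ : (φ : Arrow G v → Arrow G v) →
                              (∀ {α β} → α ~ β → φ α ~ φ β) → (∀ α → ρ G (φ α) ≡ ρ G α) →
                              Σ[ γ ∈ Walk G v v ] (∀ α → ψ G γ α ≈ φ α)
    ∼U-preserving-over-ρ⇒ψ φ φ-∼U φ-over = γ , λ { (_ , p) → agree-++ [ v ] p agree-[] }
      where
      γ : Walk G v v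
      γ = loopAt (φ (v , [ v ])) (φ-over (v , [ v ]))

      Agree : ∀ {x} → Walk G v x → Set
      Agree {x} p = ψ G γ (x , p) ≈ φ (x , p)

      agree-[] : Agree [ v ]
      agree-[] = ≈-trans (eq (≅-reflexive (++-identityʳ γ))) (loopAt-≈ _ (φ-over _))

      agree-edge : ∀ {y x} (p : Walk G v y) (e : y ∼ x) → Agree p → Agree (p ⊕ edge G e)
      agree-edge p e γp≈φp =
        ≈-trans (eq (≅-reflexive (sym (++-assoc γ p (edge G e)))))
                (∼U-unique (γ ⊕ p) e γp≈φp (φ-∼U (_ , e , ≈-refl)) (φ-over _))

      agree-++ : ∀ {y x} (p : Walk G v y) (q : Walk G y x) → Agree p → Agree (p ⊕ q)
      agree-++ p [ _ ]   = subst Agree (sym (++-identityʳ p))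
      agree-++ p (e ∷ q) = subst Agree (++-assoc p (edge G e) q)
                         ∘ agree-++ (p ⊕ edge G e) q ∘ agree-edge p e

    deck⇒ψ : (φ : Arrow G v → Arrow G v) → IsDeck G φ →
             Σ[ γ ∈ Walk G v v ] (∀ α → ψ G γ α ≈ φ α)
    deck⇒ψ φ φ-deck = ∼U-preserving-over-ρ⇒ψ φ adj-pres over
      where open IsDeck φ-deck

open Cover

theorem3p28 : (G : Graph) → Connected G → NotSingleIsolatedVertex G →
    (v : Graph.V G) →
    ((γ : Walk G v v) → IsDeck G (ψ G γ))
    × ((γ δ : Walk G v v) → _≃_ G γ δ → ∀ α → _≈ₐ_ G (ψ G γ α) (ψ G δ α))
    × ((γ δ : Walk G v v) → ∀ α →
         _≈ₐ_ G (ψ G (_++_ G γ δ) α) (ψ G γ (ψ G δ α)))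
    × ((γ δ : Walk G v v) → (∀ α → _≈ₐ_ G (ψ G γ α) (ψ G δ α)) → _≃_ G γ δ)
    × ((φ : Arrow G v → Arrow G v) → IsDeck G φ →
         Σ[ γ ∈ Walk G v v ] (∀ α → _≈ₐ_ G (ψ G γ α) (φ α)))
theorem3p28 G _ _ v = ψ-isDeck G , ψ-resp-≃ G , ψ-++ G , ψ-injective G , deck⇒ψ G
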